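{- For all integers $i,n\geq 0$, the operation $cut_r$ is a bijection from $\mathcal{A}_{i+1,0}(n+1)$ onto $\mathcal{A}_{i,*}(n)$, whose inverse is $block_c$. For all integers $j,n\geq 0$, the operation $cut_c$ is a bijection from $\mathcal{A}_{0,j+1}(n+1)$ onto $\mathcal{A}_{*,j}(n)$, whose inverse is $block_r$.
   Context: A shape of length $n$ is a Ferrers diagram in English notation (rows left-justified, stacked from the top), in which empty rows and empty columns are allowed. It is determined by its south-east border, a lattice path of $n$ unit steps, each south or west, from the top-right corner to the bottom-left corner. Each south step is the right end of a row and each west step is the bottom of a column, so the number of rows plus the number of columns is $n$. An alternative tableau is a shape together with a partial filling of its cells by left arrows $\leftarrow$ and up arrows $\uparrow$ such that every cell lying to the left of a left arrow in the same row, and every cell lying above an up arrow in the same column, is empty. Its length is the length of its shape. A free row is a row containing no left arrow; a free column is a column containing no up arrow. $\mathcal{A}_{i,j}(n)$ denotes the set of alternative tableaux of length $n$ with exactly $i$ free rows and $j$ free columns. A $*$ in place of $i$ (resp. $j$) means that the number of free rows (resp. free columns) is unrestricted. Operations: - $cut_r$ deletes the topmost row of a tableau that has at least one row and no empty column. - $cut_c$ deletes the leftmost column of a tableau that has at least one column and no empty row, so that every row length decreases by one. - $block_c(T)$ adds a new top row above $T$, with one cell in each column of $T$, and puts an up arrow in each cell of this new row that lies in a free column of $T$; the other new cells stay empty. - $block_r(T)$ adds a new leftmost column to $T$, with one cell in each row of $T$, and puts a left arrow in each cell of this new column that lies in a free row of $T$; the other new cells stay empty. -}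

module Defs where

open import Data.Nat using (ℕ; zero; suc; _+_)
open import Data.Fin using (Fin; zero; suc; _<_)
open import Data.Vec using (Vec; []; _∷_; lookup; tabulate; map; replicate; _∷ʳ_)
open import Data.Bool using (Bool; true; false; _∧_; not; if_then_else_)
open import Data.Product using (_×_)
open import Data.Empty using (⊥)
open import Relation.Binary.PropositionalEquality using (_≡_)

-- Steps of the south-east border, read from the top-right corner
-- to the bottom-left corner.
data Step : Set where
  S W : Step

data Content : Set where
  emp lft upA : Content

isS : Step → Bool
isS S = true
isS W = false

isW : Step → Bool
isW S = false
isW W = true

isLeft : Content → Bool
isLeft lft = true
isLeft _   = false

isUp : Content → Bool
isUp upA = true
isUp _   = false

-- The steps of the border are
-- indexed by positions 0..n-1.  A south step at position p is (the right end
-- of) a row, a west step at position q is (the bottom of) a column, and the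
-- cells of the diagram are exactly the pairs (p , q) with p < q,
-- step p = S and step q = W  (row p meets column q).
-- Row p' is above row p iff p' < p; column q' is left of column q iff q < q'.
-- The filling is stored as an n × n matrix; entries at non-cells must be emp.
record Tableau (n : ℕ) : Set where
  constructor tab
  field
    path : Vec Step n
    fill : Vec (Vec Content n) n
open Tableau public

entry : ∀ {n} → Tableau n → Fin n → Fin n → Content
entry T p q = lookup (lookup (fill T) p) q

IsCell : ∀ {n} → Tableau n → Fin n → Fin n → Set
IsCell T p q = (p < q) × (lookup (path T) p ≡ S) × (lookup (path T) q ≡ W)

record IsAlternative {n : ℕ} (T : Tableau n) : Set where
  field
    nonCellEmpty : ∀ p q → (IsCell T p q → ⊥) → entry T p q ≡ emp
    leftRule : ∀ p q q' → entry T p q ≡ lft → q < q' → IsCell T p q' → entry T p q' ≡ emp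
    upRule : ∀ p q p' → entry T p q ≡ upA → p' < p → IsCell T p' q → entry T p' q ≡ emp

allV : ∀ {A : Set} {m} → (A → Bool) → Vec A m → Bool
allV f []       = true
allV f (x ∷ xs) = f x ∧ allV f xs

countTrue : ∀ {m} → Vec Bool m → ℕ
countTrue []           = 0
countTrue (true ∷ bs)  = suc (countTrue bs)
countTrue (false ∷ bs) = countTrue bs

freeRow? : ∀ {n} → Tableau n → Fin n → Bool
freeRow? T p = isS (lookup (path T) p) ∧ allV (λ c → not (isLeft c)) (lookup (fill T) p)

freeCol? : ∀ {n} → Tableau n → Fin n → Bool
freeCol? T q = isW (lookup (path T) q) ∧ allV (λ row → not (isUp (lookup row q))) (fill T)

nFreeRows : ∀ {n} → Tableau n → ℕ
nFreeRows T = countTrue (tabulate (freeRow? T))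

nFreeCols : ∀ {n} → Tableau n → ℕ
nFreeCols T = countTrue (tabulate (freeCol? T))

InA : ∀ {n} → ℕ → ℕ → Tableau n → Set
InA i j T = IsAlternative T × nFreeRows T ≡ i × nFreeCols T ≡ j

InA-⋆ : ∀ {n} → ℕ → Tableau n → Set
InA-⋆ i T = IsAlternative T × nFreeRows T ≡ i

InA⋆- : ∀ {n} → ℕ → Tableau n → Set
InA⋆- j T = IsAlternative T × nFreeCols T ≡ j

dropLast : ∀ {A : Set} {m} → Vec A (suc m) → Vec A m
dropLast (x ∷ [])       = []
dropLast (x ∷ (y ∷ ys)) = x ∷ dropLast (y ∷ ys)

-- cut_r : delete the topmost row.  On its domain (at least one row, no empty
-- column) the first border step is the south step of the topmost row, so
-- deleting that row = deleting position 0 (row 0 of the matrix is the row;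
-- column 0 of the matrix contains no cells).
cutr : ∀ {n} → Tableau (suc n) → Tableau n
cutr (tab (_ ∷ w) (_ ∷ M)) = tab w (map (λ { (_ ∷ r) → r }) M)

-- cut_c : delete the leftmost column.  On its domain (at least one column, no
-- empty row) the last border step is the west step of the leftmost column;
-- deleting it shortens every row by one.
cutc : ∀ {n} → Tableau (suc n) → Tableau n
cutc (tab w M) = tab (dropLast w) (map dropLast (dropLast M))

-- block_c : new top row (new first south step) with a cell in every column,
-- an up arrow in the cells lying in free columns of T.
blockc : ∀ {n} → Tableau n → Tableau (suc n)
blockc {n} T =
  tab (S ∷ path T)
      ((emp ∷ tabulate (λ q → if freeCol? T q then upA else emp))
        ∷ map (emp ∷_) (fill T))

-- block_r : new leftmost column (new last west step) with a cell in every row,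
-- a left arrow in the cells lying in free rows of T.
blockr : ∀ {n} → Tableau n → Tableau (suc n)
blockr {n} T =
  tab (path T ∷ʳ W)
      (tabulate (λ p → lookup (fill T) p ∷ʳ (if freeRow? T p then lft else emp))
        ∷ʳ replicate (suc n) emp)

module Submission where

-- Rows.  block_c preserves alternativity, adds one free row (its new top row)
-- and leaves no free column, and cut_r undoes it.  Conversely, if T is
-- alternative without free column, then its first step is south, its first
-- (west-most) column is empty, and the up arrows of its top row sit exactly
-- above the free columns of cut_r T; hence T = block_c (cut_r T).
--
-- Columns, by duality.  Transposition (reverse the border, exchange south and
-- west steps, reflect the filling and exchange ← with ↑) is an involution on
-- alternative tableaux exchanging free rows with free columns, and it
-- conjugates cut_c into cut_r and block_r into block_c.  The column statement
-- is therefore the row statement read through the transpose.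

open import Defs
open import Function using (_∘_)
open import Data.Nat using (ℕ; zero; suc; s≤s; z≤n)
open import Data.Nat.Properties using (suc-injective; ∸-monoʳ-<)
open import Data.Fin using (Fin; zero; suc; _<_; inject₁; fromℕ; opposite)
open import Data.Fin.Properties using (opposite-prop; opposite-involutive; toℕ<n)
open import Data.Vec using (Vec; []; _∷_; lookup; tabulate; map; replicate; _∷ʳ_)
open import Data.Vec.Properties
  using (lookup-map; lookup∘tabulate; tabulate-cong; tabulate∘lookup; lookup-replicate)
open import Data.Bool using (Bool; true; false; not; if_then_else_)
open import Data.Bool.Properties using (¬-not)
open import Data.Product using (_×_; _,_; proj₁; proj₂; ∃)
open import Data.Sum using (_⊎_; inj₁; inj₂)
open import Data.Empty using (⊥-elim)
open import Relation.Nullary using (¬_)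
open import Relation.Binary.PropositionalEquality
open ≡-Reasoning
open IsAlternative

vec-ext : ∀ {A : Set} {m} (xs ys : Vec A m) → (∀ k → lookup xs k ≡ lookup ys k) → xs ≡ ys
vec-ext xs ys same =
  trans (sym (tabulate∘lookup xs)) (trans (tabulate-cong same) (tabulate∘lookup ys))

tab-ext : ∀ {n} (T U : Tableau n) → (∀ k → lookup (path T) k ≡ lookup (path U) k)
        → (∀ p q → entry T p q ≡ entry U p q) → T ≡ U
tab-ext (tab w M) (tab w′ M′) same-path same-entry =
  cong₂ tab (vec-ext w w′ same-path)
            (vec-ext M M′ (λ p → vec-ext (lookup M p) (lookup M′ p) (same-entry p)))

lookup-dropLast : ∀ {A : Set} {m} (v : Vec A (suc m)) k → lookup (dropLast v) k ≡ lookup v (inject₁ k)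
lookup-dropLast (x ∷ y ∷ ys) zero    = refl
lookup-dropLast (x ∷ y ∷ ys) (suc k) = lookup-dropLast (y ∷ ys) k

lookup-∷ʳ-inject₁ : ∀ {A : Set} {m} (v : Vec A m) x k → lookup (v ∷ʳ x) (inject₁ k) ≡ lookup v k
lookup-∷ʳ-inject₁ (y ∷ ys) x zero    = refl
lookup-∷ʳ-inject₁ (y ∷ ys) x (suc k) = lookup-∷ʳ-inject₁ ys x k

lookup-∷ʳ-last : ∀ {A : Set} {m} (v : Vec A m) x → lookup (v ∷ʳ x) (fromℕ m) ≡ x
lookup-∷ʳ-last []       x = refl
lookup-∷ʳ-last (y ∷ ys) x = lookup-∷ʳ-last ys x

lookup-map-tail : ∀ {A : Set} {k m} (f : Vec A (suc k) → Vec A k) → (∀ x r → f (x ∷ r) ≡ r)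
                → (M : Vec (Vec A (suc k)) m) (p : Fin m) (q : Fin k)
                → lookup (lookup (map f M) p) q ≡ lookup (lookup M p) (suc q)
lookup-map-tail f f-tail M p q with lookup M p | lookup-map p f M
... | x ∷ r | eq = trans (cong (λ v → lookup v q) eq) (cong (λ v → lookup v q) (f-tail x r))

data InjectOrLast : ∀ {n} → Fin (suc n) → Set where
  inject : ∀ {n} (k : Fin n) → InjectOrLast (inject₁ k)
  last   : ∀ {n} → InjectOrLast (fromℕ n)

injectOrLast : ∀ {n} (k : Fin (suc n)) → InjectOrLast k
injectOrLast {zero}  zero    = last
injectOrLast {suc n} zero    = inject zero
injectOrLast {suc n} (suc k) with injectOrLast k
... | inject k′ = inject (suc k′)
... | last      = last

opposite-< : ∀ {n} {p q : Fin n} → p < q → opposite q < opposite p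
opposite-< {p = p} {q} p<q rewrite opposite-prop p | opposite-prop q =
  ∸-monoʳ-< (s≤s p<q) (toℕ<n q)

opposite-inject₁ : ∀ {n} (i : Fin n) → opposite (inject₁ i) ≡ suc (opposite i)
opposite-inject₁ {suc n} zero    = refl
opposite-inject₁ {suc n} (suc i) = cong inject₁ (opposite-inject₁ i)

opposite-fromℕ : ∀ n → opposite (fromℕ n) ≡ zero
opposite-fromℕ zero    = refl
opposite-fromℕ (suc n) = cong inject₁ (opposite-fromℕ n)

allV-sound : ∀ {A : Set} {m} (f : A → Bool) (xs : Vec A m)
           → allV f xs ≡ true → ∀ k → f (lookup xs k) ≡ true
allV-sound f (x ∷ xs) holds k with f x in fx
allV-sound f (x ∷ xs) holds zero    | true = fx
allV-sound f (x ∷ xs) holds (suc k) | true = allV-sound f xs holds k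

allV-complete : ∀ {A : Set} {m} (f : A → Bool) (xs : Vec A m)
              → (∀ k → f (lookup xs k) ≡ true) → allV f xs ≡ true
allV-complete f []       holds = refl
allV-complete f (x ∷ xs) holds rewrite holds zero = allV-complete f xs (holds ∘ suc)

allV-false : ∀ {A : Set} {m} (f : A → Bool) (xs : Vec A m)
           → allV f xs ≡ false → ∃ λ k → f (lookup xs k) ≡ false
allV-false f (x ∷ xs) fails with f x in fx
... | true  = let (k , fk) = allV-false f xs fails in suc k , fk
... | false = zero , fx

bool-iff : (b c : Bool) → (b ≡ true → c ≡ true) → (c ≡ true → b ≡ true) → b ≡ c
bool-iff true  true  _ _ = refl
bool-iff true  false f _ = sym (f refl)
bool-iff false true  _ g = g refl
bool-iff false false _ _ = refl

count-none : ∀ {n} (f : Fin n → Bool) → countTrue (tabulate f) ≡ 0 → ∀ q → f q ≡ false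
count-none {suc n} f none q with f zero in f0
count-none {suc n} f ()   q       | true
count-none {suc n} f none zero    | false = f0
count-none {suc n} f none (suc q) | false = count-none (f ∘ suc) none q

count-none⁻¹ : ∀ {n} (f : Fin n → Bool) → (∀ q → f q ≡ false) → countTrue (tabulate f) ≡ 0
count-none⁻¹ {zero}  f none = refl
count-none⁻¹ {suc n} f none rewrite none zero = count-none⁻¹ (f ∘ suc) (none ∘ suc)

count-cons : ∀ {n} (f : Fin (suc n) → Bool) (g : Fin n → Bool)
           → f zero ≡ true → (∀ p → f (suc p) ≡ g p)
           → countTrue (tabulate f) ≡ suc (countTrue (tabulate g))
count-cons f g f0 fs rewrite f0 = cong (suc ∘ countTrue) (tabulate-cong fs)

countTrue-cong-∷ : ∀ {m} b {xs ys : Vec Bool m}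
                 → countTrue xs ≡ countTrue ys → countTrue (b ∷ xs) ≡ countTrue (b ∷ ys)
countTrue-cong-∷ true  same = cong suc same
countTrue-cong-∷ false same = same

countTrue-swap : ∀ {m} a b (xs : Vec Bool m) → countTrue (a ∷ b ∷ xs) ≡ countTrue (b ∷ a ∷ xs)
countTrue-swap true  true  xs = refl
countTrue-swap true  false xs = refl
countTrue-swap false true  xs = refl
countTrue-swap false false xs = refl

count-last-first : ∀ {n} (f : Fin (suc n) → Bool)
                 → countTrue (tabulate f) ≡ countTrue (f (fromℕ n) ∷ tabulate (f ∘ inject₁))
count-last-first {zero}  f = refl
count-last-first {suc n} f =
  trans (countTrue-cong-∷ (f zero) (count-last-first (f ∘ suc)))
        (countTrue-swap (f zero) (f (fromℕ (suc n))) _)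

count-opposite : ∀ {n} (f : Fin n → Bool) → countTrue (tabulate (f ∘ opposite)) ≡ countTrue (tabulate f)
count-opposite {zero}  f = refl
count-opposite {suc n} f =
  trans (countTrue-cong-∷ (f (fromℕ n)) (count-opposite (f ∘ inject₁))) (sym (count-last-first f))

S≢W : S ≢ W
S≢W ()

emp≢lft : emp ≢ lft
emp≢lft ()

emp≢upA : emp ≢ upA
emp≢upA ()

notLeft-sound : ∀ c → not (isLeft c) ≡ true → c ≢ lft
notLeft-sound lft () _

notLeft-complete : ∀ c → c ≢ lft → not (isLeft c) ≡ true
notLeft-complete emp _  = refl
notLeft-complete lft ne = ⊥-elim (ne refl)
notLeft-complete upA _  = refl

notLeft-false : ∀ c → not (isLeft c) ≡ false → c ≡ lft
notLeft-false lft _ = refl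

notUp-sound : ∀ c → not (isUp c) ≡ true → c ≢ upA
notUp-sound upA () _

notUp-complete : ∀ c → c ≢ upA → not (isUp c) ≡ true
notUp-complete emp _  = refl
notUp-complete lft _  = refl
notUp-complete upA ne = ⊥-elim (ne refl)

notUp-false : ∀ c → not (isUp c) ≡ false → c ≡ upA
notUp-false upA _ = refl

FreeRow : ∀ {n} → Tableau n → Fin n → Set
FreeRow U p = lookup (path U) p ≡ S × (∀ q → entry U p q ≢ lft)

FreeCol : ∀ {n} → Tableau n → Fin n → Set
FreeCol U q = lookup (path U) q ≡ W × (∀ p → entry U p q ≢ upA)

freeRow?-sound : ∀ {n} (U : Tableau n) p → freeRow? U p ≡ true → FreeRow U p
freeRow?-sound U p free with lookup (path U) p
freeRow?-sound U p free | S =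
  refl , λ q → notLeft-sound _ (allV-sound _ (lookup (fill U) p) free q)
freeRow?-sound U p ()   | W

freeRow?-complete : ∀ {n} (U : Tableau n) p → FreeRow U p → freeRow? U p ≡ true
freeRow?-complete U p (south , noLeft) rewrite south =
  allV-complete _ (lookup (fill U) p) (λ q → notLeft-complete _ (noLeft q))

freeRow?-false : ∀ {n} (U : Tableau n) p → freeRow? U p ≡ false
               → lookup (path U) p ≡ W ⊎ ∃ λ q → entry U p q ≡ lft
freeRow?-false U p notFree with lookup (path U) p
freeRow?-false U p notFree | W = inj₁ refl
freeRow?-false U p notFree | S =
  let (q , left) = allV-false _ (lookup (fill U) p) notFree in inj₂ (q , notLeft-false _ left)

freeCol?-sound : ∀ {n} (U : Tableau n) q → freeCol? U q ≡ true → FreeCol U q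
freeCol?-sound U q free with lookup (path U) q
freeCol?-sound U q free | W =
  refl , λ p → notUp-sound _ (allV-sound (λ row → not (isUp (lookup row q))) (fill U) free p)
freeCol?-sound U q ()   | S

freeCol?-complete : ∀ {n} (U : Tableau n) q → FreeCol U q → freeCol? U q ≡ true
freeCol?-complete U q (west , noUp) rewrite west =
  allV-complete (λ row → not (isUp (lookup row q))) (fill U) (λ p → notUp-complete _ (noUp p))

freeCol?-false : ∀ {n} (U : Tableau n) q → freeCol? U q ≡ false
               → lookup (path U) q ≡ S ⊎ ∃ λ p → entry U p q ≡ upA
freeCol?-false U q notFree with lookup (path U) q
freeCol?-false U q notFree | S = inj₁ refl
freeCol?-false U q notFree | W =
  let (p , up) = allV-false (λ row → not (isUp (lookup row q))) (fill U) notFree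
  in inj₂ (p , notUp-false _ up)

upArrowIf : Bool → Content
upArrowIf b = if b then upA else emp

upArrowIf-≢lft : ∀ b → upArrowIf b ≢ lft
upArrowIf-≢lft true  ()
upArrowIf-≢lft false ()

path-cutr : ∀ {n} (U : Tableau (suc n)) k → lookup (path (cutr U)) k ≡ lookup (path U) (suc k)
path-cutr (tab (s ∷ w) (r ∷ M)) k = refl

entry-cutr : ∀ {n} (U : Tableau (suc n)) p q → entry (cutr U) p q ≡ entry U (suc p) (suc q)
entry-cutr (tab (s ∷ w) (r ∷ M)) = lookup-map-tail _ (λ x r → refl) M

entry-blockc-top : ∀ {n} (T : Tableau n) q → entry (blockc T) zero (suc q) ≡ upArrowIf (freeCol? T q)
entry-blockc-top T q = lookup∘tabulate _ q

entry-blockc-left : ∀ {n} (T : Tableau n) p → entry (blockc T) p zero ≡ emp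
entry-blockc-left T zero    = refl
entry-blockc-left T (suc p) = cong (λ row → lookup row zero) (lookup-map p (emp ∷_) (fill T))

entry-blockc-inner : ∀ {n} (T : Tableau n) p q → entry (blockc T) (suc p) (suc q) ≡ entry T p q
entry-blockc-inner T p q = cong (λ row → lookup row (suc q)) (lookup-map p (emp ∷_) (fill T))

cutr-blockc : ∀ {n} (T : Tableau n) → cutr (blockc T) ≡ T
cutr-blockc T = tab-ext (cutr (blockc T)) T (λ _ → refl)
  (λ p q → trans (entry-cutr (blockc T) p q) (entry-blockc-inner T p q))

cutr-alternative : ∀ {n} (U : Tableau (suc n)) → IsAlternative U → IsAlternative (cutr U)
nonCellEmpty (cutr-alternative U@(tab (_ ∷ _) (_ ∷ _)) alt) p q notCell =
  trans (entry-cutr U p q)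
        (nonCellEmpty alt (suc p) (suc q) (λ { (s≤s p<q , south , west) → notCell (p<q , south , west) }))
leftRule (cutr-alternative U@(tab (_ ∷ _) (_ ∷ _)) alt) p q q′ left q<q′ (p<q′ , south , west) =
  trans (entry-cutr U p q′)
        (leftRule alt (suc p) (suc q) (suc q′) (trans (sym (entry-cutr U p q)) left)
                  (s≤s q<q′) (s≤s p<q′ , south , west))
upRule (cutr-alternative U@(tab (_ ∷ _) (_ ∷ _)) alt) p q p′ up p′<p (p′<q , south , west) =
  trans (entry-cutr U p′ q)
        (upRule alt (suc p) (suc q) (suc p′) (trans (sym (entry-cutr U p q)) up)
                (s≤s p′<p) (s≤s p′<q , south , west))

-- block_c preserves alternativity: its new top row only carries up arrows,
-- and each of them sits above a free column.
blockc-alternative : ∀ {n} (T : Tableau n) → IsAlternative T → IsAlternative (blockc T)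
nonCellEmpty (blockc-alternative T alt) zero zero _ = refl
nonCellEmpty (blockc-alternative T alt) zero (suc q) notCell with freeCol? T q in free
... | true  = ⊥-elim (notCell (s≤s z≤n , refl , proj₁ (freeCol?-sound T q free)))
... | false = trans (entry-blockc-top T q) (cong upArrowIf free)
nonCellEmpty (blockc-alternative T alt) (suc p) zero _ = entry-blockc-left T (suc p)
nonCellEmpty (blockc-alternative T alt) (suc p) (suc q) notCell =
  trans (entry-blockc-inner T p q)
        (nonCellEmpty alt p q (λ (p<q , south , west) → notCell (s≤s p<q , south , west)))
leftRule (blockc-alternative T alt) zero zero _ () _ _
leftRule (blockc-alternative T alt) zero (suc q) _ left _ _ =
  ⊥-elim (upArrowIf-≢lft _ (trans (sym (entry-blockc-top T q)) left))
leftRule (blockc-alternative T alt) (suc p) zero _ left _ _ =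
  ⊥-elim (emp≢lft (trans (sym (entry-blockc-left T (suc p))) left))
leftRule (blockc-alternative T alt) (suc p) (suc q) zero _ () _
leftRule (blockc-alternative T alt) (suc p) (suc q) (suc q′) left (s≤s q<q′) (s≤s p<q′ , south , west) =
  trans (entry-blockc-inner T p q′)
        (leftRule alt p q q′ (trans (sym (entry-blockc-inner T p q)) left) q<q′ (p<q′ , south , west))
upRule (blockc-alternative T alt) zero _ _ _ () _
upRule (blockc-alternative T alt) (suc p) zero _ up _ _ =
  ⊥-elim (emp≢upA (trans (sym (entry-blockc-left T (suc p))) up))
upRule (blockc-alternative T alt) (suc p) (suc q) zero up _ _ with freeCol? T q in free
... | true  = ⊥-elim (proj₂ (freeCol?-sound T q free) p (trans (sym (entry-blockc-inner T p q)) up))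
... | false = trans (entry-blockc-top T q) (cong upArrowIf free)
upRule (blockc-alternative T alt) (suc p) (suc q) (suc p′) up (s≤s p′<p) (s≤s p′<q , south , west) =
  trans (entry-blockc-inner T p′ q)
        (upRule alt p q p′ (trans (sym (entry-blockc-inner T p q)) up) p′<p (p′<q , south , west))

freeRow?-blockc-top : ∀ {n} (T : Tableau n) → freeRow? (blockc T) zero ≡ true
freeRow?-blockc-top T = freeRow?-complete (blockc T) zero (refl , noLeft)
  where
  noLeft : ∀ q → entry (blockc T) zero q ≢ lft
  noLeft zero    = emp≢lft
  noLeft (suc q) left = upArrowIf-≢lft _ (trans (sym (entry-blockc-top T q)) left)

freeRow?-blockc-below : ∀ {n} (T : Tableau n) p → freeRow? (blockc T) (suc p) ≡ freeRow? T p
freeRow?-blockc-below T p = bool-iff _ _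
  (λ free → let (south , noLeft) = freeRow?-sound (blockc T) (suc p) free in
     freeRow?-complete T p (south , λ q left → noLeft (suc q) (trans (entry-blockc-inner T p q) left)))
  (λ free → let (south , noLeft) = freeRow?-sound T p free in
     freeRow?-complete (blockc T) (suc p) (south , λ
       { zero    left → emp≢lft (trans (sym (entry-blockc-left T (suc p))) left)
       ; (suc q) left → noLeft q (trans (sym (entry-blockc-inner T p q)) left) }))

nFreeRows-blockc : ∀ {n} (T : Tableau n) → nFreeRows (blockc T) ≡ suc (nFreeRows T)
nFreeRows-blockc T =
  count-cons (freeRow? (blockc T)) (freeRow? T) (freeRow?-blockc-top T) (freeRow?-blockc-below T)

-- block_c T has no free column: every column of T gains an up arrow in the
-- new top row unless it already had one.
blockc-no-free-column : ∀ {n} (T : Tableau n) q → freeCol? (blockc T) q ≡ false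
blockc-no-free-column T zero    = refl
blockc-no-free-column T (suc q) =
  ¬-not (λ free → covered (freeCol? T q) refl (freeCol?-sound (blockc T) (suc q) free))
  where
  covered : ∀ b → freeCol? T q ≡ b → ¬ FreeCol (blockc T) (suc q)
  covered true  free    (_ , noUp) = noUp zero (trans (entry-blockc-top T q) (cong upArrowIf free))
  covered false notFree (west , noUp) with freeCol?-false T q notFree
  ... | inj₁ south     = S≢W (trans (sym south) west)
  ... | inj₂ (p , up) = noUp (suc p) (trans (entry-blockc-inner T p q) up)

-- The first step of a border is never the bottom of a nonempty column, so the
-- west-most column of an alternative tableau is empty.
first-column-empty : ∀ {n} (T : Tableau (suc n)) → IsAlternative T → ∀ p → entry T p zero ≡ emp
first-column-empty T alt p = nonCellEmpty alt p zero (λ ())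

first-step-south : ∀ {n} (T : Tableau (suc n)) → IsAlternative T → freeCol? T zero ≡ false
                 → lookup (path T) zero ≡ S
first-step-south T alt notFree with freeCol?-false T zero notFree
... | inj₁ south    = south
... | inj₂ (p , up) = ⊥-elim (emp≢upA (trans (sym (first-column-empty T alt p)) up))

top-row : ∀ {n} (T : Tableau (suc n)) → IsAlternative T → (∀ q → freeCol? T q ≡ false)
        → ∀ q → entry T zero (suc q) ≡ upArrowIf (freeCol? (cutr T) q)
top-row T alt noFree q = go (lookup (path T) (suc q)) refl (freeCol? (cutr T) q) refl
  where
  go : ∀ s → lookup (path T) (suc q) ≡ s → ∀ b → freeCol? (cutr T) q ≡ b
     → entry T zero (suc q) ≡ upArrowIf b
  -- position suc q is a row: no cell there, and no column of cutr T either
  go S south true free =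
    ⊥-elim (S≢W (trans (sym south) (trans (sym (path-cutr T q)) (proj₁ (freeCol?-sound (cutr T) q free)))))
  go S south false _ = nonCellEmpty alt zero (suc q) (λ (_ , _ , west) → S≢W (trans (sym south) west))
  -- a column that is free below the top row has its up arrow in the top row
  go W west true free with freeCol?-false T (suc q) (noFree (suc q))
  ... | inj₁ south         = ⊥-elim (S≢W (trans (sym south) west))
  ... | inj₂ (zero , up)   = up
  ... | inj₂ (suc p , up) = ⊥-elim (proj₂ (freeCol?-sound (cutr T) q free) p (trans (entry-cutr T p q) up))
  -- a column with an up arrow below the top row has an empty top cell
  go W west false notFree with freeCol?-false (cutr T) q notFree
  ... | inj₁ south = ⊥-elim (S≢W (trans (sym south) (trans (path-cutr T q) west)))
  ... | inj₂ (p , up) =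
    upRule alt (suc p) (suc q) zero (trans (sym (entry-cutr T p q)) up) (s≤s z≤n)
           (s≤s z≤n , first-step-south T alt (noFree zero) , west)

blockc-cutr : ∀ {n} (T : Tableau (suc n)) → IsAlternative T → (∀ q → freeCol? T q ≡ false)
            → blockc (cutr T) ≡ T
blockc-cutr T alt noFree = tab-ext (blockc (cutr T)) T same-path same-entry
  where
  same-path : ∀ k → lookup (path (blockc (cutr T))) k ≡ lookup (path T) k
  same-path zero    = sym (first-step-south T alt (noFree zero))
  same-path (suc k) = path-cutr T k
  same-entry : ∀ p q → entry (blockc (cutr T)) p q ≡ entry T p q
  same-entry p       zero    = trans (entry-blockc-left (cutr T) p) (sym (first-column-empty T alt p))
  same-entry zero    (suc q) = trans (entry-blockc-top (cutr T) q) (sym (top-row T alt noFree q))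
  same-entry (suc p) (suc q) = trans (entry-blockc-inner (cutr T) p q) (entry-cutr T p q)

cutr-blockc-bijection : (i n : ℕ) →
  ((T : Tableau (suc n)) → InA (suc i) 0 T → InA-⋆ i (cutr T) × blockc (cutr T) ≡ T)
  × ((T : Tableau n) → InA-⋆ i T → InA (suc i) 0 (blockc T) × cutr (blockc T) ≡ T)
cutr-blockc-bijection i n = cut , block
  where
  cut : (T : Tableau (suc n)) → InA (suc i) 0 T → InA-⋆ i (cutr T) × blockc (cutr T) ≡ T
  cut T (alt , rows , cols) = (cutr-alternative T alt , suc-injective rows-cut) , inverse
    where
    inverse : blockc (cutr T) ≡ T
    inverse = blockc-cutr T alt (count-none (freeCol? T) cols)
    rows-cut : suc (nFreeRows (cutr T)) ≡ suc i
    rows-cut = begin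
      suc (nFreeRows (cutr T))   ≡⟨ nFreeRows-blockc (cutr T) ⟨
      nFreeRows (blockc (cutr T)) ≡⟨ cong nFreeRows inverse ⟩
      nFreeRows T                 ≡⟨ rows ⟩
      suc i                       ∎
  block : (T : Tableau n) → InA-⋆ i T → InA (suc i) 0 (blockc T) × cutr (blockc T) ≡ T
  block T (alt , rows) =
    ( blockc-alternative T alt
    , trans (nFreeRows-blockc T) (cong suc rows)
    , count-none⁻¹ (freeCol? (blockc T)) (blockc-no-free-column T))
    , cutr-blockc T

swapStep : Step → Step
swapStep S = W
swapStep W = S

swapContent : Content → Content
swapContent emp = emp
swapContent lft = upA
swapContent upA = lft

swapStep-involutive : ∀ s → swapStep (swapStep s) ≡ s
swapStep-involutive S = refl
swapStep-involutive W = refl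

swapContent-involutive : ∀ c → swapContent (swapContent c) ≡ c
swapContent-involutive emp = refl
swapContent-involutive lft = refl
swapContent-involutive upA = refl

swapStep-flip : ∀ {s t} → swapStep s ≡ t → s ≡ swapStep t
swapStep-flip {S} refl = refl
swapStep-flip {W} refl = refl

swapContent-flip : ∀ {c d} → swapContent c ≡ d → c ≡ swapContent d
swapContent-flip {emp} refl = refl
swapContent-flip {lft} refl = refl
swapContent-flip {upA} refl = refl

-- The transpose reflects the diagram in its anti-diagonal: the border is read
-- backwards with south and west exchanged, position k becoming n-1-k, and
-- the arrows are exchanged.  Rows of T become columns of the transpose.
transpose : ∀ {n} → Tableau n → Tableau n
transpose T =
  tab (tabulate (λ k → swapStep (lookup (path T) (opposite k))))
      (tabulate (λ p → tabulate (λ q → swapContent (entry T (opposite q) (opposite p)))))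

path-transpose : ∀ {n} (T : Tableau n) k
               → lookup (path (transpose T)) k ≡ swapStep (lookup (path T) (opposite k))
path-transpose T k = lookup∘tabulate _ k

entry-transpose : ∀ {n} (T : Tableau n) p q
                → entry (transpose T) p q ≡ swapContent (entry T (opposite q) (opposite p))
entry-transpose T p q =
  trans (cong (λ row → lookup row q) (lookup∘tabulate _ p)) (lookup∘tabulate _ q)

path-transpose-opposite : ∀ {n} (T : Tableau n) k
                        → swapStep (lookup (path (transpose T)) (opposite k)) ≡ lookup (path T) k
path-transpose-opposite T k = begin
  swapStep (lookup (path (transpose T)) (opposite k))   ≡⟨ cong swapStep (path-transpose T (opposite k)) ⟩
  swapStep (swapStep (lookup (path T) (opposite (opposite k)))) ≡⟨ swapStep-involutive _ ⟩
  lookup (path T) (opposite (opposite k))               ≡⟨ cong (lookup (path T)) (opposite-involutive k) ⟩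
  lookup (path T) k                                     ∎

entry-transpose-opposite : ∀ {n} (T : Tableau n) p q
                         → swapContent (entry (transpose T) (opposite q) (opposite p)) ≡ entry T p q
entry-transpose-opposite T p q = begin
  swapContent (entry (transpose T) (opposite q) (opposite p))
    ≡⟨ cong swapContent (entry-transpose T (opposite q) (opposite p)) ⟩
  swapContent (swapContent (entry T (opposite (opposite p)) (opposite (opposite q))))
    ≡⟨ swapContent-involutive _ ⟩
  entry T (opposite (opposite p)) (opposite (opposite q))
    ≡⟨ cong₂ (entry T) (opposite-involutive p) (opposite-involutive q) ⟩
  entry T p q ∎

transpose-involutive : ∀ {n} (T : Tableau n) → transpose (transpose T) ≡ T
transpose-involutive T = tab-ext (transpose (transpose T)) T
  (λ k → trans (path-transpose (transpose T) k) (path-transpose-opposite T k))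
  (λ p q → trans (entry-transpose (transpose T) p q) (entry-transpose-opposite T p q))

cell-transpose : ∀ {n} (T : Tableau n) {p q} → IsCell T (opposite q) (opposite p) → IsCell (transpose T) p q
cell-transpose T {p} {q} (q<p , south , west) =
  subst₂ _<_ (opposite-involutive p) (opposite-involutive q) (opposite-< q<p) ,
  trans (path-transpose T p) (cong swapStep west) ,
  trans (path-transpose T q) (cong swapStep south)

cell-transpose⁻¹ : ∀ {n} (T : Tableau n) {p q} → IsCell (transpose T) p q → IsCell T (opposite q) (opposite p)
cell-transpose⁻¹ T {p} {q} (p<q , south , west) =
  opposite-< p<q ,
  swapStep-flip (trans (sym (path-transpose T q)) west) ,
  swapStep-flip (trans (sym (path-transpose T p)) south)

-- The two arrow rules are exchanged by transposition.
transpose-alternative : ∀ {n} (T : Tableau n) → IsAlternative T → IsAlternative (transpose T)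
nonCellEmpty (transpose-alternative T alt) p q notCell =
  trans (entry-transpose T p q)
        (cong swapContent (nonCellEmpty alt (opposite q) (opposite p) (notCell ∘ cell-transpose T)))
leftRule (transpose-alternative T alt) p q q′ left q<q′ cell =
  trans (entry-transpose T p q′)
        (cong swapContent (upRule alt (opposite q) (opposite p) (opposite q′)
                                  (swapContent-flip (trans (sym (entry-transpose T p q)) left))
                                  (opposite-< q<q′) (cell-transpose⁻¹ T cell)))
upRule (transpose-alternative T alt) p q p′ up p′<p cell =
  trans (entry-transpose T p′ q)
        (cong swapContent (leftRule alt (opposite q) (opposite p) (opposite p′)
                                    (swapContent-flip (trans (sym (entry-transpose T p q)) up))
                                    (opposite-< p′<p) (cell-transpose⁻¹ T cell)))

freeRow?-transpose : ∀ {n} (T : Tableau n) p → freeRow? (transpose T) p ≡ freeCol? T (opposite p)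
freeRow?-transpose T p = bool-iff _ _
  (λ free → let (south , noLeft) = freeRow?-sound (transpose T) p free in
     freeCol?-complete T (opposite p)
       ( swapStep-flip (trans (sym (path-transpose T p)) south)
       , λ p′ up → noLeft (opposite p′)
           (trans (entry-transpose T p (opposite p′))
                  (cong swapContent (trans (cong (λ r → entry T r (opposite p)) (opposite-involutive p′)) up)))))
  (λ free → let (west , noUp) = freeCol?-sound T (opposite p) free in
     freeRow?-complete (transpose T) p
       ( trans (path-transpose T p) (cong swapStep west)
       , λ q left → noUp (opposite q) (swapContent-flip (trans (sym (entry-transpose T p q)) left))))

-- Dually, by the involution, free columns of the transpose are reflected free rows;
-- counting over reflected positions, the numbers of free rows and columns swap.
freeCol?-transpose : ∀ {n} (T : Tableau n) p → freeCol? (transpose T) (opposite p) ≡ freeRow? T p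
freeCol?-transpose T p =
  trans (sym (freeRow?-transpose (transpose T) p)) (cong (λ U → freeRow? U p) (transpose-involutive T))

nFreeRows-transpose : ∀ {n} (T : Tableau n) → nFreeRows (transpose T) ≡ nFreeCols T
nFreeRows-transpose T =
  trans (cong countTrue (tabulate-cong (freeRow?-transpose T))) (count-opposite (freeCol? T))

nFreeCols-transpose : ∀ {n} (T : Tableau n) → nFreeCols (transpose T) ≡ nFreeRows T
nFreeCols-transpose T =
  trans (sym (nFreeRows-transpose (transpose T))) (cong nFreeRows (transpose-involutive T))

transpose-InA : ∀ {n i j} (T : Tableau n) → InA i j T → InA j i (transpose T)
transpose-InA T (alt , rows , cols) =
  transpose-alternative T alt , trans (nFreeRows-transpose T) cols , trans (nFreeCols-transpose T) rows

transpose-InA⋆- : ∀ {n j} (T : Tableau n) → InA⋆- j T → InA-⋆ j (transpose T)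
transpose-InA⋆- T (alt , cols) = transpose-alternative T alt , trans (nFreeRows-transpose T) cols

transpose-InA-⋆ : ∀ {n i} (T : Tableau n) → InA-⋆ i T → InA⋆- i (transpose T)
transpose-InA-⋆ T (alt , rows) = transpose-alternative T alt , trans (nFreeCols-transpose T) rows

entry-cutc : ∀ {n} (U : Tableau (suc n)) p q → entry (cutc U) p q ≡ entry U (inject₁ p) (inject₁ q)
entry-cutc U p q = begin
  lookup (lookup (map dropLast (dropLast (fill U))) p) q
    ≡⟨ cong (λ row → lookup row q) (lookup-map p dropLast (dropLast (fill U))) ⟩
  lookup (dropLast (lookup (dropLast (fill U)) p)) q
    ≡⟨ lookup-dropLast (lookup (dropLast (fill U)) p) q ⟩
  lookup (lookup (dropLast (fill U)) p) (inject₁ q)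
    ≡⟨ cong (λ row → lookup row (inject₁ q)) (lookup-dropLast (fill U) p) ⟩
  entry U (inject₁ p) (inject₁ q) ∎

cutc-transpose : ∀ {n} (T : Tableau (suc n)) → cutc T ≡ transpose (cutr (transpose T))
cutc-transpose T = tab-ext (cutc T) (transpose (cutr (transpose T))) same-path same-entry
  where
  same-path : ∀ k → lookup (path (cutc T)) k ≡ lookup (path (transpose (cutr (transpose T)))) k
  same-path k = sym (begin
    lookup (path (transpose (cutr (transpose T)))) k     ≡⟨ path-transpose (cutr (transpose T)) k ⟩
    swapStep (lookup (path (cutr (transpose T))) (opposite k))
      ≡⟨ cong swapStep (path-cutr (transpose T) (opposite k)) ⟩
    swapStep (lookup (path (transpose T)) (suc (opposite k)))
      ≡⟨ cong (λ k′ → swapStep (lookup (path (transpose T)) k′)) (opposite-inject₁ k) ⟨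
    swapStep (lookup (path (transpose T)) (opposite (inject₁ k)))
      ≡⟨ path-transpose-opposite T (inject₁ k) ⟩
    lookup (path T) (inject₁ k)                          ≡⟨ lookup-dropLast (path T) k ⟨
    lookup (path (cutc T)) k                             ∎)
  same-entry : ∀ p q → entry (cutc T) p q ≡ entry (transpose (cutr (transpose T))) p q
  same-entry p q = sym (begin
    entry (transpose (cutr (transpose T))) p q           ≡⟨ entry-transpose (cutr (transpose T)) p q ⟩
    swapContent (entry (cutr (transpose T)) (opposite q) (opposite p))
      ≡⟨ cong swapContent (entry-cutr (transpose T) (opposite q) (opposite p)) ⟩
    swapContent (entry (transpose T) (suc (opposite q)) (suc (opposite p)))
      ≡⟨ cong₂ (λ q′ p′ → swapContent (entry (transpose T) q′ p′)) (opposite-inject₁ q) (opposite-inject₁ p) ⟨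
    swapContent (entry (transpose T) (opposite (inject₁ q)) (opposite (inject₁ p)))
      ≡⟨ entry-transpose-opposite T (inject₁ p) (inject₁ q) ⟩
    entry T (inject₁ p) (inject₁ q)                      ≡⟨ entry-cutc T p q ⟨
    entry (cutc T) p q                                   ∎)

leftArrowIf : Bool → Content
leftArrowIf b = if b then lft else emp

swap-upArrowIf : ∀ b → swapContent (upArrowIf b) ≡ leftArrowIf b
swap-upArrowIf true  = refl
swap-upArrowIf false = refl

row-blockr : ∀ {n} (T : Tableau n) p
           → lookup (fill (blockr T)) (inject₁ p) ≡ lookup (fill T) p ∷ʳ leftArrowIf (freeRow? T p)
row-blockr T p = trans (lookup-∷ʳ-inject₁ (tabulate _) _ p) (lookup∘tabulate _ p)

entry-blockr-inner : ∀ {n} (T : Tableau n) p q → entry (blockr T) (inject₁ p) (inject₁ q) ≡ entry T p q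
entry-blockr-inner T p q =
  trans (cong (λ row → lookup row (inject₁ q)) (row-blockr T p)) (lookup-∷ʳ-inject₁ (lookup (fill T) p) _ q)

entry-blockr-new : ∀ {n} (T : Tableau n) p
                 → entry (blockr T) (inject₁ p) (fromℕ n) ≡ leftArrowIf (freeRow? T p)
entry-blockr-new T p =
  trans (cong (λ row → lookup row (fromℕ _)) (row-blockr T p)) (lookup-∷ʳ-last (lookup (fill T) p) _)

entry-blockr-bottom : ∀ {n} (T : Tableau n) q → entry (blockr T) (fromℕ n) q ≡ emp
entry-blockr-bottom {n} T q =
  trans (cong (λ row → lookup row q) (lookup-∷ʳ-last extended-rows (replicate (suc n) emp)))
        (lookup-replicate q emp)
  where
  extended-rows : Vec (Vec Content (suc n)) n
  extended-rows = tabulate (λ p → lookup (fill T) p ∷ʳ leftArrowIf (freeRow? T p))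

blockcᵀ : ∀ {n} → Tableau n → Tableau (suc n)
blockcᵀ T = transpose (blockc (transpose T))

path-blockcᵀ : ∀ {n} (T : Tableau n) k
             → lookup (path (blockcᵀ T)) k ≡ swapStep (lookup (S ∷ path (transpose T)) (opposite k))
path-blockcᵀ T = path-transpose (blockc (transpose T))

entry-blockcᵀ : ∀ {n} (T : Tableau n) p q
              → entry (blockcᵀ T) p q ≡ swapContent (entry (blockc (transpose T)) (opposite q) (opposite p))
entry-blockcᵀ T = entry-transpose (blockc (transpose T))

path-blockr-blockcᵀ : ∀ {n} (T : Tableau n) k → lookup (path (blockr T)) k ≡ lookup (path (blockcᵀ T)) k
path-blockr-blockcᵀ {n} T k with injectOrLast k
... | inject p = sym (begin
  lookup (path (blockcᵀ T)) (inject₁ p)                             ≡⟨ path-blockcᵀ T (inject₁ p) ⟩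
  swapStep (lookup (S ∷ path (transpose T)) (opposite (inject₁ p)))
    ≡⟨ cong (λ k′ → swapStep (lookup (S ∷ path (transpose T)) k′)) (opposite-inject₁ p) ⟩
  swapStep (lookup (path (transpose T)) (opposite p))               ≡⟨ path-transpose-opposite T p ⟩
  lookup (path T) p                                                 ≡⟨ lookup-∷ʳ-inject₁ (path T) W p ⟨
  lookup (path (blockr T)) (inject₁ p)                              ∎)
... | last = begin
  lookup (path (blockr T)) (fromℕ n)                                ≡⟨ lookup-∷ʳ-last (path T) W ⟩
  W
    ≡⟨ cong (λ k′ → swapStep (lookup (S ∷ path (transpose T)) k′)) (opposite-fromℕ n) ⟨
  swapStep (lookup (S ∷ path (transpose T)) (opposite (fromℕ n)))   ≡⟨ path-blockcᵀ T (fromℕ n) ⟨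
  lookup (path (blockcᵀ T)) (fromℕ n)                               ∎

entry-blockr-blockcᵀ : ∀ {n} (T : Tableau n) p q → entry (blockr T) p q ≡ entry (blockcᵀ T) p q
entry-blockr-blockcᵀ {n} T p q with injectOrLast p | injectOrLast q
... | inject p′ | inject q′ = sym (begin
  entry (blockcᵀ T) (inject₁ p′) (inject₁ q′)                        ≡⟨ entry-blockcᵀ T (inject₁ p′) (inject₁ q′) ⟩
  swapContent (entry (blockc (transpose T)) (opposite (inject₁ q′)) (opposite (inject₁ p′)))
    ≡⟨ cong₂ (λ a b → swapContent (entry (blockc (transpose T)) a b)) (opposite-inject₁ q′) (opposite-inject₁ p′) ⟩
  swapContent (entry (blockc (transpose T)) (suc (opposite q′)) (suc (opposite p′)))
    ≡⟨ cong swapContent (entry-blockc-inner (transpose T) (opposite q′) (opposite p′)) ⟩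
  swapContent (entry (transpose T) (opposite q′) (opposite p′))     ≡⟨ entry-transpose-opposite T p′ q′ ⟩
  entry T p′ q′                                                     ≡⟨ entry-blockr-inner T p′ q′ ⟨
  entry (blockr T) (inject₁ p′) (inject₁ q′)                        ∎)
... | inject p′ | last = sym (begin
  entry (blockcᵀ T) (inject₁ p′) (fromℕ n)                           ≡⟨ entry-blockcᵀ T (inject₁ p′) (fromℕ n) ⟩
  swapContent (entry (blockc (transpose T)) (opposite (fromℕ n)) (opposite (inject₁ p′)))
    ≡⟨ cong₂ (λ a b → swapContent (entry (blockc (transpose T)) a b)) (opposite-fromℕ n) (opposite-inject₁ p′) ⟩
  swapContent (entry (blockc (transpose T)) zero (suc (opposite p′)))
    ≡⟨ cong swapContent (entry-blockc-top (transpose T) (opposite p′)) ⟩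
  swapContent (upArrowIf (freeCol? (transpose T) (opposite p′)))   ≡⟨ cong (swapContent ∘ upArrowIf) (freeCol?-transpose T p′) ⟩
  swapContent (upArrowIf (freeRow? T p′))                           ≡⟨ swap-upArrowIf (freeRow? T p′) ⟩
  leftArrowIf (freeRow? T p′)                                       ≡⟨ entry-blockr-new T p′ ⟨
  entry (blockr T) (inject₁ p′) (fromℕ n)                           ∎)
... | last | _ = begin
  entry (blockr T) (fromℕ n) q                                      ≡⟨ entry-blockr-bottom T q ⟩
  emp                                                               ≡⟨ cong swapContent (entry-blockc-left (transpose T) (opposite q)) ⟨
  swapContent (entry (blockc (transpose T)) (opposite q) zero)
    ≡⟨ cong (λ a → swapContent (entry (blockc (transpose T)) (opposite q) a)) (opposite-fromℕ n) ⟨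
  swapContent (entry (blockc (transpose T)) (opposite q) (opposite (fromℕ n))) ≡⟨ entry-blockcᵀ T (fromℕ n) q ⟨
  entry (blockcᵀ T) (fromℕ n) q                                     ∎

blockr-transpose : ∀ {n} (T : Tableau n) → blockr T ≡ transpose (blockc (transpose T))
blockr-transpose T = tab-ext (blockr T) (blockcᵀ T) (path-blockr-blockcᵀ T) (entry-blockr-blockcᵀ T)

cutc-blockr-bijection : (j n : ℕ) →
  ((T : Tableau (suc n)) → InA 0 (suc j) T → InA⋆- j (cutc T) × blockr (cutc T) ≡ T)
  × ((T : Tableau n) → InA⋆- j T → InA 0 (suc j) (blockr T) × cutc (blockr T) ≡ T)
cutc-blockr-bijection j n = cut , block
  where
  τ : ∀ {m} → Tableau m → Tableau m
  τ = transpose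
  cut : (T : Tableau (suc n)) → InA 0 (suc j) T → InA⋆- j (cutc T) × blockr (cutc T) ≡ T
  cut T inA = subst (InA⋆- j) (sym (cutc-transpose T)) (transpose-InA-⋆ (cutr (τ T)) cutInA) , inverse
    where
    cutInA : InA-⋆ j (cutr (τ T))
    cutInA = proj₁ (proj₁ (cutr-blockc-bijection j n) (τ T) (transpose-InA T inA))
    blockCut : blockc (cutr (τ T)) ≡ τ T
    blockCut = proj₂ (proj₁ (cutr-blockc-bijection j n) (τ T) (transpose-InA T inA))
    inverse : blockr (cutc T) ≡ T
    inverse = begin
      blockr (cutc T)                   ≡⟨ blockr-transpose (cutc T) ⟩
      τ (blockc (τ (cutc T)))           ≡⟨ cong (τ ∘ blockc ∘ τ) (cutc-transpose T) ⟩
      τ (blockc (τ (τ (cutr (τ T)))))   ≡⟨ cong (τ ∘ blockc) (transpose-involutive (cutr (τ T))) ⟩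
      τ (blockc (cutr (τ T)))           ≡⟨ cong τ blockCut ⟩
      τ (τ T)                           ≡⟨ transpose-involutive T ⟩
      T                                 ∎
  block : (T : Tableau n) → InA⋆- j T → InA 0 (suc j) (blockr T) × cutc (blockr T) ≡ T
  block T inA = subst (InA 0 (suc j)) (sym (blockr-transpose T)) (transpose-InA (blockc (τ T)) blockInA) , inverse
    where
    blockInA : InA (suc j) 0 (blockc (τ T))
    blockInA = proj₁ (proj₂ (cutr-blockc-bijection j n) (τ T) (transpose-InA⋆- T inA))
    cutBlock : cutr (blockc (τ T)) ≡ τ T
    cutBlock = proj₂ (proj₂ (cutr-blockc-bijection j n) (τ T) (transpose-InA⋆- T inA))
    inverse : cutc (blockr T) ≡ T
    inverse = begin
      cutc (blockr T)                   ≡⟨ cutc-transpose (blockr T) ⟩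
      τ (cutr (τ (blockr T)))           ≡⟨ cong (τ ∘ cutr ∘ τ) (blockr-transpose T) ⟩
      τ (cutr (τ (τ (blockc (τ T)))))   ≡⟨ cong (τ ∘ cutr) (transpose-involutive (blockc (τ T))) ⟩
      τ (cutr (blockc (τ T)))           ≡⟨ cong τ cutBlock ⟩
      τ (τ T)                           ≡⟨ transpose-involutive T ⟩
      T                                 ∎

proposition2p5 :
  ((i n : ℕ) →
    ((T : Tableau (suc n)) → InA (suc i) 0 T → InA-⋆ i (cutr T) × blockc (cutr T) ≡ T)
    × ((T : Tableau n) → InA-⋆ i T → InA (suc i) 0 (blockc T) × cutr (blockc T) ≡ T))
  × ((j n : ℕ) →
    ((T : Tableau (suc n)) → InA 0 (suc j) T → InA⋆- j (cutc T) × blockr (cutc T) ≡ T)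
    × ((T : Tableau n) → InA⋆- j T → InA 0 (suc j) (blockr T) × cutc (blockr T) ≡ T))
proposition2p5 = cutr-blockc-bijection , cutc-blockr-bijection
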